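{- Let $S$ be a colored string of length $n$ with coloring $f$, fix a color $y$, let $\mathcal{T}$ be the suffix tree of $S^{\mathrm{rev}}\$$, and fix an integer $d\ge 0$. Let $H$ be an array indexed by the nodes of $\mathcal{T}$, initialized with $H(u)=h(u,d+1)$ for every node $u$. Suppose that for every node $u$ with $H(u)=d$ one (i) sets $H(u)=h(u,d)$, and (ii) for every ancestor $p$ of $u$ sets $H(p)=\min\{H(p),h(u,d)\}$. Then afterwards $H(u)=h(u,d)$ for every node $u$ of $\mathcal{T}$.
   Context: A colored string is a string $S=S[1,n]$ over a finite alphabet $\Sigma$ with a coloring $f:\{1,\ldots,n\}\to\Gamma$, $\Gamma$ finite. In the suffix tree $\mathcal{T}$ of $S^{\mathrm{rev}}\$$ ($\$\notin\Sigma$, $S^{\mathrm{rev}}$ the reverse of $S$), each of the $n+1$ leaves $v$ carries the label $\mathit{ln}(v)\in\{1,\ldots,n+1\}$, the starting position in $S^{\mathrm{rev}}\$$ of the suffix it represents. For an integer $\ell$ define $h(u,\ell)$ recursively: if $u$ is a leaf, let $j=n-\mathit{ln}(u)+1$; if $\mathit{ln}(u)<\ell$ then $h(u,\ell)=\ell-1$; otherwise, if there exists an integer $i$ with $0\le i<\ell$, $1\le j+i\le n$ and $f(j+i)=y$, then $h(u,\ell)$ is the largest such $i$; otherwise $h(u,\ell)=-1$. If $u$ is an internal node, $h(u,\ell)=\min\{h(v,\ell): v \text{ a child of } u\}$. -}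

module Defs where

open import Data.Nat using (ℕ; zero; suc; _+_; _∸_; _<_; _<?_)
open import Data.Fin using (Fin; fromℕ<)
import Data.Fin.Properties as FinP
open import Data.Maybe using (Maybe; just; nothing)
import Data.Maybe.Properties as MaybeP
open import Data.List using (List; []; _∷_; _++_; [_]; _∷ʳ_; map; reverse; tabulate; length; inits; tails; concatMap; filter; foldl; foldr)
import Data.List.Properties as ListP
open import Data.List.Relation.Unary.All using (All)
open import Data.List.Relation.Unary.All.Properties using (¬Any⇒All¬)
import Data.List.Relation.Unary.All as All
open import Data.List.Relation.Binary.Prefix.Heterogeneous using (Prefix)
open import Data.List.Relation.Binary.Prefix.Heterogeneous.Properties using (prefix?)
open import Data.List.Relation.Binary.Suffix.Heterogeneous using (Suffix)
open import Data.List.Relation.Binary.Suffix.Heterogeneous.Properties using (suffix?)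
open import Data.List.Relation.Binary.Infix.Heterogeneous using (Infix)
open import Data.List.Relation.Binary.Infix.Heterogeneous.Properties using (infix?)
open import Data.Integer using (ℤ; +_; -1ℤ; 1ℤ; _-_; _⊓_)
open import Data.Product using (Σ; ∃; _×_; _,_)
open import Data.Sum using (_⊎_; inj₁; inj₂)
open import Relation.Nullary using (Dec; yes; no; ¬_)
open import Relation.Nullary.Decidable using (_×-dec_; _⊎-dec_; ¬?; map′)
open import Relation.Binary.PropositionalEquality using (_≡_; _≢_; refl)
open import Relation.Binary.Definitions using (DecidableEquality)

∃Maybe? : ∀ {σ : ℕ} {P : Maybe (Fin σ) → Set} →
          Dec (P nothing) → ((a : Fin σ) → Dec (P (just a))) → Dec (∃ P)
∃Maybe? {P = P} dn dj with dn
... | yes p = yes (nothing , p)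
... | no ¬p with FinP.any? dj
...   | yes (a , q) = yes (just a , q)
...   | no ¬q = no λ { (nothing , p) → ¬p p ; (just a , q) → ¬q (a , q) }

-- Symbols of S^rev $ are  Maybe (Fin σ) :  just a  is the letter a,
-- nothing  is the end marker  $ .  A node of the suffix tree is identified
-- with its path label (the string spelled from the root to it):
--   * the root is the empty string,
--   * the leaves are the (nonempty) suffixes of S^rev $,
--   * the remaining internal nodes are the right-branching substrings w
--     (wa and wb both occur for two distinct symbols a ≠ b).
-- p is an ancestor of u iff p is a node and a proper prefix of u;
-- v is a child of u iff v is a node, u is a proper prefix of v and no node
-- lies strictly in between.

module SuffixTree {σ n : ℕ} (S : Fin n → Fin σ) where

  Sym : Set
  Sym = Maybe (Fin σ)

  Str : Set
  Str = List Sym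

  _≟ₛ_ : DecidableEquality Sym
  _≟ₛ_ = MaybeP.≡-dec FinP._≟_

  _≟_ : DecidableEquality Str
  _≟_ = ListP.≡-dec _≟ₛ_

  text : Str
  text = map just (reverse (tabulate S)) ++ [ nothing ]

  IsRoot : Str → Set
  IsRoot u = u ≡ []

  IsLeaf : Str → Set
  IsLeaf u = u ≢ [] × Suffix _≡_ u text

  IsBranching : Str → Set
  IsBranching u = ∃ λ a → ∃ λ b → a ≢ b × Infix _≡_ (u ∷ʳ a) text × Infix _≡_ (u ∷ʳ b) text

  IsNode : Str → Set
  IsNode u = IsRoot u ⊎ IsLeaf u ⊎ IsBranching u

  ProperPrefix : Str → Str → Set
  ProperPrefix p u = Prefix _≡_ p u × length p < length u

  IsAncestor : Str → Str → Set
  IsAncestor p u = IsNode p × ProperPrefix p u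

  -- v is a child of u  (every proper prefix of v occurs in  inits v)
  IsChild : Str → Str → Set
  IsChild u v = IsNode v × ProperPrefix u v ×
                All (λ w → ¬ (IsNode w × ProperPrefix u w × ProperPrefix w v)) (inits v)

  isRoot? : (u : Str) → Dec (IsRoot u)
  isRoot? u = u ≟ []

  isLeaf? : (u : Str) → Dec (IsLeaf u)
  isLeaf? u = ¬? (u ≟ []) ×-dec suffix? _≟ₛ_ u text

  isBranching? : (u : Str) → Dec (IsBranching u)
  isBranching? u = ∃Maybe? (ex nothing) (λ a → ex (just a))
    where
    occ? : (c : Sym) → Dec (Infix _≡_ (u ∷ʳ c) text)
    occ? c = infix? _≟ₛ_ (u ∷ʳ c) text
    ex : (a : Sym) → Dec (∃ λ b → a ≢ b × Infix _≡_ (u ∷ʳ a) text × Infix _≡_ (u ∷ʳ b) text)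
    ex a = ∃Maybe? (¬? (a ≟ₛ nothing) ×-dec occ? a ×-dec occ? nothing)
                   (λ b → ¬? (a ≟ₛ just b) ×-dec occ? a ×-dec occ? (just b))

  isNode? : (u : Str) → Dec (IsNode u)
  isNode? u = isRoot? u ⊎-dec isLeaf? u ⊎-dec isBranching? u

  properPrefix? : (p u : Str) → Dec (ProperPrefix p u)
  properPrefix? p u = prefix? _≟ₛ_ p u ×-dec (length p <? length u)

  isAncestor? : (p u : Str) → Dec (IsAncestor p u)
  isAncestor? p u = isNode? p ×-dec properPrefix? p u

  isChild? : (u v : Str) → Dec (IsChild u v)
  isChild? u v = isNode? v ×-dec properPrefix? u v ×-dec
    All.all? (λ w → ¬? (isNode? w ×-dec properPrefix? u w ×-dec properPrefix? w v)) (inits v)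

  substrings : List Str
  substrings = concatMap inits (tails text)

  nodes : List Str
  nodes = filter isNode? substrings

  children : Str → List Str
  children u = filter (isChild? u) nodes

module Colored {σ γ n : ℕ} (S : Fin n → Fin σ) (f : Fin n → Fin γ) (y : Fin γ) where

  open SuffixTree S public

  -- color of position p ∈ {1..n} of S (nothing outside that range)
  colorAt : ℕ → Maybe (Fin γ)
  colorAt zero = nothing
  colorAt (suc k) with k <? n
  ... | yes k<n = just (f (fromℕ< k<n))
  ... | no _    = nothing

  -- leaf number ln(u) = starting position of the suffix u in  S^rev $
  ln : Str → ℕ
  ln u = (n + 2) ∸ length u

  largestHit : ℕ → ℕ → ℤ
  largestHit j zero = -1ℤ
  largestHit j (suc i) with MaybeP.≡-dec FinP._≟_ (colorAt (j + i)) (just y)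
  ... | yes _ = + i
  ... | no  _ = largestHit j i

  hLeaf : Str → ℕ → ℤ
  hLeaf u ℓ with ln u <? ℓ
  ... | yes _ = (+ ℓ) - 1ℤ
  ... | no  _ = largestHit ((n + 1) ∸ ln u) ℓ

  -- minimum of a list of integers (only used on nonempty lists)
  minimum : List ℤ → ℤ
  minimum []       = -1ℤ
  minimum (x ∷ xs) = foldr _⊓_ x xs

  -- recursion with fuel (the depth of the tree is at most  length text)
  hFuel : ℕ → Str → ℕ → ℤ
  hFuel zero    u ℓ = -1ℤ
  hFuel (suc k) u ℓ with isLeaf? u
  ... | yes _ = hLeaf u ℓ
  ... | no  _ = minimum (map (λ v → hFuel k v ℓ) (children u))

  h : Str → ℕ → ℤ
  h u ℓ = hFuel (suc (length text)) u ℓ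

  step : ℕ → Str → (Str → ℤ) → (Str → ℤ)
  step d u H w with w ≟ u
  ... | yes _ = h u d
  ... | no  _ with isAncestor? w u
  ...   | yes _ = H w ⊓ h u d
  ...   | no  _ = H w

  run : ℕ → List Str → (Str → ℤ) → (Str → ℤ)
  run d us H = foldl (λ H' u → step d u H') H us

-- A node's value h(u, ℓ) is the minimum of the leaf values h(s, ℓ) over the leaves s below u.
-- At a leaf, h(s, d+1) is either d or equal to h(s, d); hence h(·, d) ≤ h(·, d+1) everywhere,
-- and h(·, d) is monotone from the root downwards.  A node u whose value is not d keeps
-- H(u) ≥ h(u, d), since every update of H(u) is a minimum with h(w, d) for a descendant w.
-- For the matching upper bound take the leaf s realising h(u, d): either h(s, d+1) = d, so s
-- itself was updated and pulled H(u) down to h(s, d), or h(u, d+1) ≤ h(s, d+1) = h(s, d)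
-- already.  A node whose value was d is set to h(u, d), and later updates from its descendants
-- cannot lower it.
module Submission where

open import Defs
open import Data.Nat using (ℕ; zero; suc; _+_; _<?_) renaming (_≤_ to _≤ℕ_; _<_ to _<ℕ_)
import Data.Nat.Properties as ℕ
open import Data.Fin using (Fin)
import Data.Fin.Properties as Fin
open import Data.Maybe using (just; nothing)
import Data.Maybe.Properties as Maybe
open import Data.List using (List; []; _∷_; _++_; _∷ʳ_; [_]; map; length; inits; tails; concatMap)
open import Data.List.Properties using (foldr-preservesᵒ)
open import Data.List.Membership.Propositional using (_∈_; _∉_)
open import Data.List.Membership.Propositional.Properties
  using (∈-map⁺; ∈-map⁻; ∈-filter⁺; ∈-filter⁻; ∈-concatMap⁺; foldr-selective)
open import Data.List.Relation.Unary.Any using (Any; here; there; satisfied)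
import Data.List.Relation.Unary.Any as Any
import Data.List.Relation.Unary.All as All
open import Data.List.Relation.Unary.All.Properties using (¬Any⇒All¬)
open import Data.List.Relation.Unary.Unique.Propositional using (Unique)
open import Data.List.Relation.Unary.AllPairs using (_∷_)
open import Data.List.Relation.Binary.Pointwise using (≡⇒Pointwise-≡; Pointwise-≡⇒≡)
open import Data.List.Relation.Binary.Prefix.Heterogeneous using (Prefix; []; _∷_; _++ᵖ_)
import Data.List.Relation.Binary.Prefix.Heterogeneous.Properties as Prefix
open import Data.List.Relation.Binary.Suffix.Heterogeneous using (Suffix; here; there)
import Data.List.Relation.Binary.Suffix.Heterogeneous.Properties as Suffix
open import Data.List.Relation.Binary.Infix.Heterogeneous using (Infix; here; there)
open import Data.List.Relation.Binary.Infix.Heterogeneous.Properties using (fromPrefixSuffix)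
open import Data.Integer using (ℤ; +_; _⊓_; _-_; 1ℤ) renaming (_≤_ to _≤ℤ_)
import Data.Integer.Properties as ℤ
open import Data.Product using (_×_; _,_; proj₁; proj₂; ∃)
open import Data.Sum using (_⊎_; inj₁; inj₂)
open import Data.Empty using (⊥-elim)
open import Function.Bundles using (_⇔_; Equivalence)
open import Relation.Nullary using (yes; no; ¬_)
open import Relation.Nullary.Decidable using (_×-dec_)
open import Relation.Binary.PropositionalEquality using (_≡_; _≢_; refl; sym; trans; cong; subst)

module _ {A : Set} where

  infix 4 _⊑_

  _⊑_ : List A → List A → Set
  _⊑_ = Prefix _≡_

  ⊑-refl : (xs : List A) → xs ⊑ xs
  ⊑-refl xs = Prefix.fromPointwise (≡⇒Pointwise-≡ refl)

  ⊑-trans : {xs ys zs : List A} → xs ⊑ ys → ys ⊑ zs → xs ⊑ zs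
  ⊑-trans = Prefix.trans trans

  ++-⊑ : (xs : List A) {zs ys : List A} → xs ++ zs ⊑ ys → xs ⊑ ys
  ++-⊑ xs {zs} = ⊑-trans (⊑-refl xs ++ᵖ zs)

  ⊑∧≢⇒length< : {xs ys : List A} → xs ⊑ ys → xs ≢ ys → length xs <ℕ length ys
  ⊑∧≢⇒length< p xs≢ys with ℕ.m≤n⇒m<n∨m≡n (Prefix.length-mono p)
  ... | inj₁ lt = lt
  ... | inj₂ eq = ⊥-elim (xs≢ys (Pointwise-≡⇒≡ (Prefix.toPointwise eq p)))

  ∷ʳ≢[] : (xs : List A) {x : A} → xs ∷ʳ x ≢ []
  ∷ʳ≢[] []      ()
  ∷ʳ≢[] (_ ∷ _) ()

  ⊑-nonempty : {xs ys : List A} → xs ⊑ ys → xs ≢ [] → ys ≢ []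
  ⊑-nonempty []      xs≢[] = ⊥-elim (xs≢[] refl)
  ⊑-nonempty (_ ∷ _) _     ()

  ⊑⇒∈inits : {xs ys : List A} → xs ⊑ ys → xs ∈ inits ys
  ⊑⇒∈inits [] = here refl
  ⊑⇒∈inits {ys = y ∷ _} (refl ∷ p) with ⊑⇒∈inits p
  ... | here refl = there (here refl)
  ... | there m   = there (there (∈-map⁺ (y ∷_) m))

  infix⇒∈substrings : {xs ys : List A} → Infix _≡_ xs ys → xs ∈ concatMap inits (tails ys)
  infix⇒∈substrings i = ∈-concatMap⁺ inits (any-tail i)
    where
    any-tail : ∀ {xs ys} → Infix _≡_ xs ys → Any (λ t → xs ∈ inits t) (tails ys)
    any-tail (here p)  = here (⊑⇒∈inits p)
    any-tail (there i) = there (any-tail i)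

  infix⇒⊑suffix : {xs ys : List A} → Infix _≡_ xs ys → ∃ λ t → Suffix _≡_ t ys × xs ⊑ t
  infix⇒⊑suffix {ys = ys} (here p) = ys , Suffix.fromPointwise (≡⇒Pointwise-≡ refl) , p
  infix⇒⊑suffix (there i) with infix⇒⊑suffix i
  ... | t , suf , p = t , there suf , p

⊓-≤ : ∀ {z} a b → a ≤ℤ z ⊎ b ≤ℤ z → a ⊓ b ≤ℤ z
⊓-≤ a b (inj₁ a≤z) = ℤ.i≤j⇒i⊓k≤j b a≤z
⊓-≤ a b (inj₂ b≤z) = ℤ.i≤j⇒k⊓i≤j a b≤z

module Properties {σ γ n : ℕ} (S : Fin n → Fin σ) (f : Fin n → Fin γ) (y : Fin γ) where

  open Colored S f y
  open ℤ.≤-Reasoning renaming (step-≤ to ≤-step)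

  minimum-≤ : {xs : List ℤ} {z : ℤ} → z ∈ xs → minimum xs ≤ℤ z
  minimum-≤ {x ∷ xs} {z} z∈xs =
    foldr-preservesᵒ {P = _≤ℤ z} ⊓-≤ x xs (Any.toSum (Any.map (λ { refl → ℤ.≤-refl }) z∈xs))

  minimum-∈ : {xs : List ℤ} {z : ℤ} → z ∈ xs → minimum xs ∈ xs
  minimum-∈ {x ∷ xs} _ with foldr-selective ℤ.⊓-sel x xs
  ... | inj₁ eq = here eq
  ... | inj₂ m  = there m

  leaf-shape : ∀ {s} → IsLeaf s → ∃ λ zs → s ≡ map just zs ++ [ nothing ]
  leaf-shape (s≢[] , suf) = go _ suf s≢[]
    where
    go : ∀ (zs : List (Fin σ)) {s} → Suffix _≡_ s (map just zs ++ [ nothing ]) → s ≢ [] →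
         ∃ λ zs′ → s ≡ map just zs′ ++ [ nothing ]
    go []       (here eq)         _    = [] , Pointwise-≡⇒≡ eq
    go []       (there (here eq)) s≢[] = ⊥-elim (s≢[] (Pointwise-≡⇒≡ eq))
    go (z ∷ zs) (here eq)         _    = z ∷ zs , Pointwise-≡⇒≡ eq
    go (_ ∷ zs) (there suf)       s≢[] = go zs suf s≢[]

  leaf-⊑-leaf : ∀ {u s} → IsLeaf u → IsLeaf s → u ⊑ s → u ≡ s
  leaf-⊑-leaf lu ls with leaf-shape lu | leaf-shape ls
  ... | xs , refl | zs , refl = go xs zs
    where
    go : ∀ (xs zs : List (Fin σ)) → map just xs ++ [ nothing ] ⊑ map just zs ++ [ nothing ] →
         map just xs ++ [ nothing ] ≡ map just zs ++ [ nothing ]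
    go []       []       _          = refl
    go (x ∷ xs) (z ∷ zs) (refl ∷ p) = cong (just x ∷_) (go xs zs p)
    go []       (_ ∷ _)  (() ∷ _)
    go (_ ∷ _)  []       (() ∷ _)

  text-isLeaf : IsLeaf text
  text-isLeaf = ∷ʳ≢[] _ , Suffix.fromPointwise (≡⇒Pointwise-≡ refl)

  leaf-isNode : ∀ {s} → IsLeaf s → IsNode s
  leaf-isNode ls = inj₂ (inj₁ ls)

  node-⊑-leaf : ∀ {u} → IsNode u → ∃ λ s → IsLeaf s × u ⊑ s
  node-⊑-leaf (inj₁ refl)         = text , text-isLeaf , []
  node-⊑-leaf {u} (inj₂ (inj₁ lu)) = u , lu , ⊑-refl u
  node-⊑-leaf {u} (inj₂ (inj₂ (_ , _ , _ , occ , _))) with infix⇒⊑suffix occ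
  ... | s , suf , ua⊑s = s , (⊑-nonempty ua⊑s (∷ʳ≢[] u) , suf) , ++-⊑ u ua⊑s

  node-length≤ : ∀ {u} → IsNode u → length u ≤ℕ length text
  node-length≤ nu with node-⊑-leaf nu
  ... | _ , (_ , suf) , u⊑s = ℕ.≤-trans (Prefix.length-mono u⊑s) (Suffix.length-mono suf)

  node-∈-nodes : ∀ {u} → IsNode u → u ∈ nodes
  node-∈-nodes nu with node-⊑-leaf nu
  ... | _ , (_ , suf) , u⊑s =
    ∈-filter⁺ isNode? (infix⇒∈substrings (fromPrefixSuffix trans u⊑s suf)) nu

  child-∈-children : ∀ {u v} → IsChild u v → v ∈ children u
  child-∈-children {u} c = ∈-filter⁺ (isChild? u) (node-∈-nodes (proj₁ c)) c

  ∈-children⇒child : ∀ {u v} → v ∈ children u → IsChild u v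
  ∈-children⇒child {u} m = proj₂ (∈-filter⁻ (isChild? u) {xs = nodes} m)

  child-towards : ∀ {u t} → IsNode t → ProperPrefix u t → ∃ λ v → IsChild u v × v ⊑ t
  child-towards {u} {t} = go (length t) ℕ.≤-refl
    where
    go : ∀ k {t} → length t ≤ℕ k → IsNode t → ProperPrefix u t → ∃ λ v → IsChild u v × v ⊑ t
    go zero    t≤0 _ (_ , u<t) = ⊥-elim (ℕ.n≮0 (ℕ.<-≤-trans u<t t≤0))
    go (suc k) {t} t≤k nt u⊏t
      with Any.any? (λ w → isNode? w ×-dec properPrefix? u w ×-dec properPrefix? w t) (inits t)
    ... | no none = t , (nt , u⊏t , ¬Any⇒All¬ (inits t) none) , ⊑-refl t
    ... | yes some with satisfied some
    ...   | w , nw , u⊏w , (w⊑t , w<t) with go k (ℕ.≤-pred (ℕ.<-≤-trans w<t t≤k)) nw u⊏w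
    ...     | v , c , v⊑w = v , c , ⊑-trans v⊑w w⊑t

  LeafMin : Str → ℕ → ℤ → Set
  LeafMin u ℓ z = (∀ s → IsLeaf s → u ⊑ s → z ≤ℤ hLeaf s ℓ)
                × (∃ λ s → IsLeaf s × u ⊑ s × z ≡ hLeaf s ℓ)

  leaf-LeafMin : ∀ {s} ℓ → IsLeaf s → LeafMin s ℓ (hLeaf s ℓ)
  leaf-LeafMin {s} ℓ ls =
      (λ s′ ls′ s⊑s′ → ℤ.≤-reflexive (cong (λ w → hLeaf w ℓ) (leaf-⊑-leaf ls ls′ s⊑s′)))
    , (s , ls , ⊑-refl s , refl)

  minimum-LeafMin : ∀ {u} ℓ (g : Str → ℤ) → IsNode u → ¬ IsLeaf u →
                    (∀ v → IsChild u v → LeafMin v ℓ (g v)) →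
                    LeafMin u ℓ (minimum (map g (children u)))
  minimum-LeafMin {u} ℓ g nu ¬lu children-min = lower , attained
    where
    toward : ∀ {s} → IsLeaf s → u ⊑ s → ∃ λ v → IsChild u v × v ⊑ s
    toward ls u⊑s = child-towards (leaf-isNode ls) (u⊑s , ⊑∧≢⇒length< u⊑s λ { refl → ¬lu ls })

    lower : ∀ s → IsLeaf s → u ⊑ s → minimum (map g (children u)) ≤ℤ hLeaf s ℓ
    lower s ls u⊑s with toward ls u⊑s
    ... | v , c , v⊑s =
      ℤ.≤-trans (minimum-≤ (∈-map⁺ g (child-∈-children c))) (proj₁ (children-min v c) s ls v⊑s)

    attained : ∃ λ s → IsLeaf s × u ⊑ s × minimum (map g (children u)) ≡ hLeaf s ℓ
    attained with node-⊑-leaf nu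
    ... | s , ls , u⊑s with toward ls u⊑s
    ... | v , c , _ with ∈-map⁻ g (minimum-∈ (∈-map⁺ g (child-∈-children c)))
    ... | w , w∈ , min≡gw with ∈-children⇒child w∈
    ... | cw@(_ , (u⊑w , _) , _) with proj₂ (children-min w cw)
    ... | s′ , ls′ , w⊑s′ , gw≡ = s′ , ls′ , ⊑-trans u⊑w w⊑s′ , trans min≡gw gw≡

  hFuel-LeafMin : ∀ k {u} ℓ → IsNode u → length text <ℕ length u + k →
                  LeafMin u ℓ (hFuel k u ℓ)
  hFuel-LeafMin zero {u} ℓ nu fuel =
    ⊥-elim (ℕ.<⇒≱ fuel (subst (_≤ℕ length text) (sym (ℕ.+-identityʳ (length u)))
                                                 (node-length≤ nu)))
  hFuel-LeafMin (suc k) {u} ℓ nu fuel with isLeaf? u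
  ... | yes lu  = leaf-LeafMin ℓ lu
  ... | no  ¬lu = minimum-LeafMin ℓ (λ v → hFuel k v ℓ) nu ¬lu
                    (λ v (nv , (_ , u<v) , _) → hFuel-LeafMin k ℓ nv (fuel-child {v} u<v))
    where
    fuel-child : ∀ {v} → length u <ℕ length v → length text <ℕ length v + k
    fuel-child u<v = ℕ.≤-trans fuel
      (ℕ.≤-trans (ℕ.≤-reflexive (ℕ.+-suc (length u) k)) (ℕ.+-monoˡ-≤ k u<v))

  h-LeafMin : ∀ {u} ℓ → IsNode u → LeafMin u ℓ (h u ℓ)
  h-LeafMin {u} ℓ nu = hFuel-LeafMin (suc (length text)) ℓ nu (ℕ.m≤n+m _ (length u))

  h-leaf : ∀ {s} ℓ → IsLeaf s → h s ℓ ≡ hLeaf s ℓ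
  h-leaf {s} ℓ ls with isLeaf? s
  ... | yes _   = refl
  ... | no  ¬ls = ⊥-elim (¬ls ls)

  largestHit≤ : ∀ j m → largestHit j m ≤ℤ (+ m) - 1ℤ
  largestHit≤ j zero = ℤ.≤-refl
  largestHit≤ j (suc i) with Maybe.≡-dec Fin._≟_ (colorAt (j + i)) (just y)
  ... | yes _ = ℤ.≤-refl
  ... | no  _ = ℤ.≤-trans (largestHit≤ j i) (ℤ.i-j≤i (+ i) 1ℤ)

  largestHit-suc : ∀ j d → largestHit j (suc d) ≡ + d ⊎ largestHit j (suc d) ≡ largestHit j d
  largestHit-suc j d with Maybe.≡-dec Fin._≟_ (colorAt (j + d)) (just y)
  ... | yes _ = inj₁ refl
  ... | no  _ = inj₂ refl

  hLeaf≤ : ∀ s d → hLeaf s d ≤ℤ (+ d) - 1ℤ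
  hLeaf≤ s d with ln s <? d
  ... | yes _ = ℤ.≤-refl
  ... | no  _ = largestHit≤ _ d

  hLeaf-suc : ∀ s d → hLeaf s (suc d) ≡ + d ⊎ hLeaf s (suc d) ≡ hLeaf s d
  hLeaf-suc s d with ln s <? suc d
  ... | yes _ = inj₁ refl
  ... | no ln≮1+d with ln s <? d
  ...   | yes ln<d = ⊥-elim (ln≮1+d (ℕ.m<n⇒m<1+n ln<d))
  ...   | no  _    = largestHit-suc _ d

  hLeaf-mono : ∀ s d → hLeaf s d ≤ℤ hLeaf s (suc d)
  hLeaf-mono s d with hLeaf-suc s d
  ... | inj₁ eq = begin
    hLeaf s d       ≤⟨ hLeaf≤ s d ⟩
    (+ d) - 1ℤ      ≤⟨ ℤ.i-j≤i (+ d) 1ℤ ⟩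
    + d             ≡⟨ eq ⟨
    hLeaf s (suc d) ∎
  ... | inj₂ eq = ℤ.≤-reflexive (sym eq)

  h-mono-⊑ : ∀ {u w} ℓ → IsNode u → IsNode w → u ⊑ w → h u ℓ ≤ℤ h w ℓ
  h-mono-⊑ {u} {w} ℓ nu nw u⊑w with proj₂ (h-LeafMin ℓ nw)
  ... | s , ls , w⊑s , hw≡ = begin
    h u ℓ     ≤⟨ proj₁ (h-LeafMin ℓ nu) s ls (⊑-trans u⊑w w⊑s) ⟩
    hLeaf s ℓ ≡⟨ hw≡ ⟨
    h w ℓ     ∎

  h-mono-suc : ∀ {u} d → IsNode u → h u d ≤ℤ h u (suc d)
  h-mono-suc {u} d nu with proj₂ (h-LeafMin (suc d) nu)
  ... | s , ls , u⊑s , hu≡ = begin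
    h u d           ≤⟨ proj₁ (h-LeafMin d nu) s ls u⊑s ⟩
    hLeaf s d       ≤⟨ hLeaf-mono s d ⟩
    hLeaf s (suc d) ≡⟨ hu≡ ⟨
    h u (suc d)     ∎

  module _ (d : ℕ) where

    step-self : ∀ u H → step d u H u ≡ h u d
    step-self u H with u ≟ u
    ... | yes _   = refl
    ... | no  u≢u = ⊥-elim (u≢u refl)

    step-≤ : ∀ {u w} H → u ≢ w → step d w H u ≤ℤ H u
    step-≤ {u} {w} H u≢w with u ≟ w
    ... | yes u≡w = ⊥-elim (u≢w u≡w)
    ... | no  _ with isAncestor? u w
    ...   | yes _ = ℤ.i⊓j≤i _ _
    ...   | no  _ = ℤ.≤-refl

    step-≤-descendant : ∀ {u w} H → u ≢ w → IsAncestor u w → step d w H u ≤ℤ h w d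
    step-≤-descendant {u} {w} H u≢w anc with u ≟ w
    ... | yes u≡w = ⊥-elim (u≢w u≡w)
    ... | no  _ with isAncestor? u w
    ...   | yes _    = ℤ.i⊓j≤j _ _
    ...   | no  ¬anc = ⊥-elim (¬anc anc)

    step-≥ : ∀ {u w b} H → u ≢ w → b ≤ℤ H u → (IsAncestor u w → b ≤ℤ h w d) → b ≤ℤ step d w H u
    step-≥ {u} {w} H u≢w b≤H b≤h with u ≟ w
    ... | yes u≡w = ⊥-elim (u≢w u≡w)
    ... | no  _ with isAncestor? u w
    ...   | yes anc = ℤ.⊓-glb b≤H (b≤h anc)
    ...   | no  _   = b≤H

    run-≤ : ∀ {u} us H → u ∉ us → run d us H u ≤ℤ H u
    run-≤ []       H _   = ℤ.≤-refl
    run-≤ (w ∷ ws) H u∉ =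
      ℤ.≤-trans (run-≤ ws (step d w H) (λ m → u∉ (there m))) (step-≤ H (λ eq → u∉ (here eq)))

    run-≤-descendant : ∀ {u s} us H → u ∉ us → s ∈ us → IsAncestor u s → run d us H u ≤ℤ h s d
    run-≤-descendant (w ∷ ws) H u∉ (here refl) anc =
      ℤ.≤-trans (run-≤ ws (step d w H) (λ m → u∉ (there m)))
                (step-≤-descendant H (λ eq → u∉ (here eq)) anc)
    run-≤-descendant (w ∷ ws) H u∉ (there s∈) anc =
      run-≤-descendant ws (step d w H) (λ m → u∉ (there m)) s∈ anc

    run-≥ : ∀ {u b} us H → u ∉ us → b ≤ℤ H u → (∀ w → w ∈ us → IsAncestor u w → b ≤ℤ h w d) →
            b ≤ℤ run d us H u
    run-≥ []       H _   b≤H _   = b≤H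
    run-≥ (w ∷ ws) H u∉ b≤H b≤h =
      run-≥ ws (step d w H) (λ m → u∉ (there m))
            (step-≥ H (λ eq → u∉ (here eq)) b≤H (b≤h w (here refl))) (λ w′ m → b≤h w′ (there m))

    run-self : ∀ {u} us H → u ∈ us → Unique us → (∀ w → w ∈ us → IsAncestor u w → h u d ≤ℤ h w d) →
               run d us H u ≡ h u d
    run-self (u ∷ ws) H (here refl) (u∉ws ∷ _) desc = ℤ.≤-antisym
      (ℤ.≤-trans (run-≤ ws (step d u H) u∉) (ℤ.≤-reflexive (step-self u H)))
      (run-≥ ws (step d u H) u∉ (ℤ.≤-reflexive (sym (step-self u H))) (λ w m → desc w (there m)))
      where
      u∉ : u ∉ ws
      u∉ m = All.lookup u∉ws m refl
    run-self (w ∷ ws) H (there u∈) (_ ∷ unique) desc =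
      run-self ws (step d w H) u∈ unique (λ w′ m → desc w′ (there m))

    H₀ : Str → ℤ
    H₀ v = h v (suc d)

    run-≤-h : ∀ {u} us → IsNode u → u ∉ us → (∀ {s} → IsLeaf s → h s (suc d) ≡ + d → s ∈ us) →
              run d us H₀ u ≤ℤ h u d
    run-≤-h {u} us nu u∉ updated with proj₂ (h-LeafMin d nu)
    ... | s , ls , u⊑s , hu≡ with hLeaf-suc s d
    ... | inj₁ hs≡d = begin
      run d us H₀ u ≤⟨ run-≤-descendant us H₀ u∉ s∈ (nu , u⊑s , ⊑∧≢⇒length< u⊑s u≢s) ⟩
      h s d         ≡⟨ h-leaf d ls ⟩
      hLeaf s d     ≡⟨ hu≡ ⟨
      h u d         ∎
      where
      s∈ : s ∈ us
      s∈ = updated ls (trans (h-leaf (suc d) ls) hs≡d)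
      u≢s : u ≢ s
      u≢s refl = u∉ s∈
    ... | inj₂ hs≡ = begin
      run d us H₀ u   ≤⟨ run-≤ us H₀ u∉ ⟩
      h u (suc d)     ≤⟨ proj₁ (h-LeafMin (suc d) nu) s ls u⊑s ⟩
      hLeaf s (suc d) ≡⟨ hs≡ ⟩
      hLeaf s d       ≡⟨ hu≡ ⟨
      h u d           ∎

lemma4 : ∀ {σ γ n : ℕ} (S : Fin n → Fin σ) (f : Fin n → Fin γ) (y : Fin γ) (d : ℕ)
           (order : List (SuffixTree.Str S)) →
           Unique order →
           (∀ u → (u ∈ order) ⇔ (SuffixTree.IsNode S u × Colored.h S f y u (suc d) ≡ + d)) →
           ∀ u → SuffixTree.IsNode S u →
           Colored.run S f y d order (λ v → Colored.h S f y v (suc d)) u ≡ Colored.h S f y u d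
lemma4 S f y d order unique order-spec u nu = proof
  where
  open Colored S f y
  open Properties S f y
  open Equivalence

  h≤descendants : ∀ w → w ∈ order → IsAncestor u w → h u d ≤ℤ h w d
  h≤descendants w w∈ (_ , u⊑w , _) = h-mono-⊑ d nu (proj₁ (to (order-spec w) w∈)) u⊑w

  proof : run d order (H₀ d) u ≡ h u d
  proof with h u (suc d) ℤ.≟ + d
  ... | yes hu≡d = run-self d order (H₀ d) (from (order-spec u) (nu , hu≡d)) unique h≤descendants
  ... | no  hu≢d = ℤ.≤-antisym
    (run-≤-h d order nu u∉ (λ ls hs≡d → from (order-spec _) (leaf-isNode ls , hs≡d)))
    (run-≥ d order (H₀ d) u∉ (h-mono-suc d nu) h≤descendants)
    where
    u∉ : u ∉ order
    u∉ u∈ = hu≢d (proj₂ (to (order-spec u) u∈))
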